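{- Let $P:\{0,1\}^k\to\{0,1\}$ be a symmetric predicate, let $H$ be a $k$-uniform hypergraph, and let $T=(V,E)$ be a subgraph of $H$ that is a hypertree. Then for any $v\in V$, the random variables $\mathbf{x}_v$ and $\mathbf{b}_E=\{\mathbf{b}_e\}_{e\in E}$ are independent under $\mathcal{D}_H$.
   Context: $P$ symmetric means $|P^{ -1}(1)|>0$, $P(x)=P(y)$ whenever $x,y$ have equal Hamming weight, and $P(x)=P((1,\dots,1)-x)$ for all $x$. For a $k$-uniform hypergraph $H$ with vertex set $V_H$ (edges being ordered $k$-tuples $(v_1,\dots,v_k)$), $\mathcal{D}_H$ is the distribution that chooses $\mathbf{x}=(\mathbf{x}_v)_{v\in V_H}$ uniformly at random in $\{0,1\}^{V_H}$ and then, independently for each edge $e=(v_1,\dots,v_k)$ of $H$, chooses $\mathbf{b}_e$ uniformly at random from $\{b\in\{0,1\}^k: P((\mathbf{x}_{v_1},\dots,\mathbf{x}_{v_k})+b)=1\}$ (addition mod 2). A hypercycle is a sequence of vertices $v_1,\dots,v_p$ and edges $e_1,\dots,e_p$ with $e_i\ni v_i,v_{(i\bmod p)+1}$; a hyperpath is defined analogously with $e_i\ni v_i,v_{i+1}$ for $i\le p-1$. A hypergraph is connected if every two vertices lie on a common hyperpath, and a hypertree is a connected hypergraph with no hypercycle. -}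

module Defs where

open import Data.Bool using (Bool; true; false; not; if_then_else_; _xor_; _∧_)
open import Data.Nat using (ℕ; zero; suc; _^_; _≤_)
open import Data.Fin using (Fin; zero; suc; inject₁; fromℕ)
open import Data.Fin.Subset using (Subset; _∈_)
open import Data.Vec using (Vec; []; _∷_; lookup; map; zipWith)
import Data.Vec.Properties as VecP
open import Data.List using (List; []; _∷_; concatMap; allFin)
import Data.List as L
import Data.Nat.ListAction as NLA
import Data.Bool.ListAction as BLA
open import Data.Integer using (+_)
open import Data.Rational using (ℚ; _/_; 0ℚ; 1ℚ; _+_; _*_)
open import Data.Product using (Σ; ∃; _×_; _,_)
open import Data.Bool.Properties using () renaming (_≟_ to _≟B_)
open import Relation.Nullary.Decidable using (⌊_⌋)
open import Relation.Binary.PropositionalEquality using (_≡_)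
import Data.Empty
open import Function.Definitions using (Injective)
import Data.Vec.Membership.Propositional as VM

weight : ∀ {k} → Vec Bool k → ℕ
weight []          = 0
weight (true ∷ x)  = suc (weight x)
weight (false ∷ x) = weight x

complement : ∀ {k} → Vec Bool k → Vec Bool k
complement = map not

_⊕_ : ∀ {k} → Vec Bool k → Vec Bool k → Vec Bool k
_⊕_ = zipWith _xor_

record Symmetric {k : ℕ} (P : Vec Bool k → Bool) : Set where
  field
    nonempty  : ∃ λ x → P x ≡ true
    weightInv : ∀ x y → weight x ≡ weight y → P x ≡ P y
    complInv  : ∀ x → P x ≡ P (complement x)

record Hypergraph (k : ℕ) : Set where
  field
    n    : ℕ
    m    : ℕ
    edge : Fin m → Vec (Fin n) k
open Hypergraph public

_∈ₑ_ : ∀ {k} {H : Hypergraph k} → Fin (n H) → Fin (m H) → Set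
_∈ₑ_ {H = H} v e = v VM.∈ edge H e

record Subgraph {k} (H : Hypergraph k) : Set where
  field
    V : Subset (n H)
    E : Subset (m H)
    closed : ∀ e → e ∈ E → ∀ v → _∈ₑ_ {H = H} v e → v ∈ V
open Subgraph public

record Hyperpath {k} {H : Hypergraph k} (T : Subgraph H) : Set where
  field
    len   : ℕ
    verts : Fin (suc len) → Fin (n H)
    edges : Fin len → Fin (m H)
    vertsIn : ∀ i → verts i ∈ V T
    edgesIn : ∀ i → edges i ∈ E T
    left  : ∀ i → _∈ₑ_ {H = H} (verts (inject₁ i)) (edges i)
    right : ∀ i → _∈ₑ_ {H = H} (verts (suc i)) (edges i)
open Hyperpath public

-- A hypercycle in T (Berge cycle): p = suc q ≥ 2 distinct vertices
-- w_0..w_q and p distinct edges e_0..e_q with e_i ∋ w_i, w_{(i+1) mod p}.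
record Hypercycle {k} {H : Hypergraph k} (T : Subgraph H) : Set where
  field
    q     : ℕ
    q≥1   : 1 ≤ q
    verts : Fin (suc q) → Fin (n H)
    edges : Fin (suc q) → Fin (m H)
    vertsInj : Injective _≡_ _≡_ verts
    edgesInj : Injective _≡_ _≡_ edges
    vertsIn : ∀ i → verts i ∈ V T
    edgesIn : ∀ i → edges i ∈ E T
    here  : ∀ i → _∈ₑ_ {H = H} (verts i) (edges i)
    next  : ∀ (i : Fin q) → _∈ₑ_ {H = H} (verts (suc i)) (edges (inject₁ i))
    close : _∈ₑ_ {H = H} (verts zero) (edges (fromℕ q))

Connected : ∀ {k} {H : Hypergraph k} → Subgraph H → Set
Connected {H = H} T =
  ∀ u w → u ∈ V T → w ∈ V T →
    Σ (Hyperpath T) λ π → (∃ λ i → verts π i ≡ u) × (∃ λ j → verts π j ≡ w)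

record Hypertree {k} {H : Hypergraph k} (T : Subgraph H) : Set where
  field
    connected : Connected T
    acyclic   : Hypercycle T → Data.Empty.⊥

allVec : {A : Set} → List A → (l : ℕ) → List (Vec A l)
allVec xs zero    = [] ∷ []
allVec xs (suc l) = concatMap (λ a → L.map (a ∷_) (allVec xs l)) xs

bools : List Bool
bools = false ∷ true ∷ []

countB : ∀ k → (Vec Bool k → Bool) → ℕ
countB k f = NLA.sum (L.map (λ v → if f v then 1 else 0) (allVec bools k))

-- 1/c (with the convention 1/0 = 0, never used under our hypotheses)
inv : ℕ → ℚ
inv zero    = 0ℚ
inv (suc c) = + 1 / suc c

sumℚ : List ℚ → ℚ
sumℚ = L.foldr _+_ 0ℚ

prodℚ : List ℚ → ℚ
prodℚ = L.foldr _*_ 1ℚ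

module Dist {k : ℕ} (P : Vec Bool k → Bool) (H : Hypergraph k) where

  Assignment : Set
  Assignment = Vec Bool (n H)

  Labels : Set
  Labels = Vec (Vec Bool k) (m H)

  xOn : Assignment → Fin (m H) → Vec Bool k
  xOn x e = map (lookup x) (edge H e)

  edgeProb : Assignment → Fin (m H) → Vec Bool k → ℚ
  edgeProb x e c =
    if P (xOn x e ⊕ c) then inv (countB k (λ c' → P (xOn x e ⊕ c'))) else 0ℚ

  prob : Assignment → Labels → ℚ
  prob x b = inv (2 ^ n H) * prodℚ (L.map (λ e → edgeProb x e (lookup b e)) (allFin (m H)))

  Pr : (Assignment → Labels → Bool) → ℚ
  Pr A = sumℚ (concatMap (λ x → L.map (λ b → if A x b then prob x b else 0ℚ)
                                      (allVec (allVec bools k) (m H)))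
                         (allVec bools (n H)))

  xIs : Fin (n H) → Bool → Assignment → Labels → Bool
  xIs v a x b = ⌊ lookup x v ≟B a ⌋

  bIs : Subset (m H) → Labels → Assignment → Labels → Bool
  bIs E β x b = BLA.and (L.map (λ e → if lookup E e then ⌊ VecP.≡-dec _≟B_ (lookup b e) (lookup β e) ⌋ else true)
                              (allFin (m H)))

  Independent : Fin (n H) → Subset (m H) → Set
  Independent v E = ∀ (a : Bool) (β : Labels) →
    Pr (λ x b → xIs v a x b ∧ bIs E β x b) ≡ Pr (xIs v a) * Pr (bIs E β)

-- The global flip x ↦ complement x is a bijection of {0,1}^V_H that
-- preserves the weight D_H(x, b): because P(y) = P(1 - y), the set of
-- admissible labels of an edge e, {c : P(x_e + c) = 1}, does not change when
-- x is complemented, so neither does any factor of D_H(x, b).  The flip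
-- exchanges the events "x_v = a" and "x_v = ¬a" and fixes every event that
-- only looks at the labels b.  Hence for such an event B
--   Pr[x_v = a ∧ B] = Pr[x_v = ¬a ∧ B] = Pr[B] / 2,
-- and taking B to be certain (D_H has total mass 1) gives Pr[x_v = a] = 1/2;
-- together Pr[x_v = a ∧ B] = Pr[x_v = a] · Pr[B].  The argument works for
-- every vertex and every set of edges.
module Submission where

open import Defs
open import Data.Bool using (Bool; true; false; not; if_then_else_; _xor_; _∧_)
open import Data.Nat using (ℕ)
open import Data.Vec using (Vec)
open import Data.Fin.Subset using (_∈_)

import Data.Bool.Properties as BP
open BP using () renaming (_≟_ to _≟B_)
import Data.Nat as N
import Data.Nat.Properties as NP
import Data.Nat.ListAction as NLA
open import Data.Fin using (Fin; zero; suc)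
import Data.Vec as V
import Data.Vec.Properties as VP
import Data.List as L
open import Data.List using (List; []; _∷_; _++_; concatMap; allFin; tabulate)
import Data.List.Properties as LP
open import Data.List.Membership.Propositional using () renaming (_∈_ to _∈L_)
import Data.List.Membership.Propositional.Properties as LMP
open import Data.List.Relation.Unary.Any using (here; there)
import Data.Integer as Z
import Data.Integer.Properties as ZP
open import Data.Rational using (ℚ; _/_; 0ℚ; 1ℚ; _+_; _*_; toℚᵘ)
import Data.Rational.Properties as QP
open import Data.Rational.Solver using (module +-*-Solver)
import Data.Rational.Unnormalised as U
import Data.Rational.Unnormalised.Properties as UP
open import Data.Product using (∃; _,_)
open import Relation.Nullary.Decidable using (⌊_⌋)
open import Relation.Binary.PropositionalEquality

∑ : {A : Set} → List A → (A → ℚ) → ℚ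
∑ xs f = sumℚ (L.map f xs)

sumℚ-++ : (ys zs : List ℚ) → sumℚ (ys ++ zs) ≡ sumℚ ys + sumℚ zs
sumℚ-++ []       zs = sym (QP.+-identityˡ _)
sumℚ-++ (y ∷ ys) zs = trans (cong (y +_) (sumℚ-++ ys zs)) (sym (QP.+-assoc y _ _))

sumℚ-concatMap : {A : Set} (f : A → List ℚ) (xs : List A) →
  sumℚ (concatMap f xs) ≡ ∑ xs (λ a → sumℚ (f a))
sumℚ-concatMap f []       = refl
sumℚ-concatMap f (x ∷ xs) =
  trans (sumℚ-++ (f x) (concatMap f xs)) (cong (sumℚ (f x) +_) (sumℚ-concatMap f xs))

∑-concatMap : {A B : Set} (h : A → List B) (g : B → ℚ) (xs : List A) →
  ∑ (concatMap h xs) g ≡ ∑ xs (λ a → ∑ (h a) g)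
∑-concatMap h g xs =
  trans (cong sumℚ (LP.map-concatMap g h xs)) (sumℚ-concatMap (λ a → L.map g (h a)) xs)

∑-map : {A B : Set} (g : A → B) (f : B → ℚ) (xs : List A) →
  ∑ (L.map g xs) f ≡ ∑ xs (λ a → f (g a))
∑-map g f xs = cong sumℚ (sym (LP.map-∘ xs))

∑-cong : {A : Set} {f g : A → ℚ} (xs : List A) → (∀ a → f a ≡ g a) → ∑ xs f ≡ ∑ xs g
∑-cong xs f≗g = cong sumℚ (LP.map-cong f≗g xs)

∑-+ : {A : Set} (f g : A → ℚ) (xs : List A) → ∑ xs (λ a → f a + g a) ≡ ∑ xs f + ∑ xs g
∑-+ f g []       = sym (QP.+-identityˡ 0ℚ)
∑-+ f g (x ∷ xs) = trans (cong (f x + g x +_) (∑-+ f g xs)) (interchange (f x) (g x) _ _)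
  where
  open +-*-Solver
  interchange : ∀ a b c d → (a + b) + (c + d) ≡ (a + c) + (b + d)
  interchange = solve 4 (λ a b c d → (a :+ b) :+ (c :+ d) := (a :+ c) :+ (b :+ d)) refl

∑-*ˡ : {A : Set} (r : ℚ) (f : A → ℚ) (xs : List A) → ∑ xs (λ a → r * f a) ≡ r * ∑ xs f
∑-*ˡ r f []       = sym (QP.*-zeroʳ r)
∑-*ˡ r f (x ∷ xs) = trans (cong (r * f x +_) (∑-*ˡ r f xs)) (sym (QP.*-distribˡ-+ r (f x) _))

∑-*ʳ : {A : Set} (r : ℚ) (f : A → ℚ) (xs : List A) → ∑ xs (λ a → f a * r) ≡ ∑ xs f * r
∑-*ʳ r f []       = sym (QP.*-zeroˡ r)
∑-*ʳ r f (x ∷ xs) = trans (cong (f x * r +_) (∑-*ʳ r f xs)) (sym (QP.*-distribʳ-+ r (f x) _))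

prodℚ-ones : ∀ {l} {f : Fin l → ℚ} → (∀ i → f i ≡ 1ℚ) → prodℚ (tabulate f) ≡ 1ℚ
prodℚ-ones {N.zero}  f≡1 = refl
prodℚ-ones {N.suc l} f≡1 =
  trans (cong₂ _*_ (f≡1 zero) (prodℚ-ones (λ i → f≡1 (suc i)))) (QP.*-identityˡ 1ℚ)

half-times-double : ∀ {p q r : ℚ} → p ≡ q + q → 1ℚ ≡ r + r → r * p ≡ q
half-times-double {p} {q} {r} p≡2q 1≡2r = begin
  r * p         ≡⟨ cong (r *_) p≡2q ⟩
  r * (q + q)   ≡⟨ doubling r q ⟩
  (r + r) * q   ≡⟨ cong (_* q) 1≡2r ⟨
  1ℚ * q        ≡⟨ QP.*-identityˡ q ⟩
  q             ∎
  where
  open ≡-Reasoning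
  open +-*-Solver
  doubling : ∀ r q → r * (q + q) ≡ (r + r) * q
  doubling = solve 2 (λ r q → r :* (q :+ q) := (r :+ r) :* q) refl

∑-allVec-suc : {A : Set} (xs : List A) (l : ℕ) (g : Vec A (N.suc l) → ℚ) →
  ∑ (allVec xs (N.suc l)) g ≡ ∑ xs (λ a → ∑ (allVec xs l) (λ w → g (a V.∷ w)))
∑-allVec-suc xs l g =
  trans (∑-concatMap _ g xs) (∑-cong xs (λ a → ∑-map (a V.∷_) g (allVec xs l)))

∑-cube-complement : ∀ l (g : Vec Bool l → ℚ) →
  ∑ (allVec bools l) g ≡ ∑ (allVec bools l) (λ x → g (complement x))
∑-cube-complement N.zero    g = refl
∑-cube-complement (N.suc l) g = begin
  ∑ (allVec bools (N.suc l)) g                   ≡⟨ ∑-allVec-suc bools l g ⟩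
  Sum false + (Sum true + 0ℚ)                    ≡⟨ cong (Sum false +_) (QP.+-identityʳ _) ⟩
  Sum false + Sum true                           ≡⟨ QP.+-comm (Sum false) (Sum true) ⟩
  Sum true + Sum false                           ≡⟨ cong₂ _+_ (flipped true) (flipped false) ⟩
  Flip true + Flip false                         ≡⟨ cong (Flip true +_) (sym (QP.+-identityʳ _)) ⟩
  Flip true + (Flip false + 0ℚ)                  ≡⟨ sym (∑-allVec-suc bools l (λ x → g (complement x))) ⟩
  ∑ (allVec bools (N.suc l)) (λ x → g (complement x)) ∎
  where
  open ≡-Reasoning
  Sum Flip : Bool → ℚ
  Sum  a = ∑ (allVec bools l) (λ w → g (a V.∷ w))
  Flip a = ∑ (allVec bools l) (λ w → g (a V.∷ complement w))
  flipped : ∀ a → Sum a ≡ Flip a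
  flipped a = ∑-cube-complement l (λ w → g (a V.∷ w))

∑-allVec-product : {A : Set} (xs : List A) (l : ℕ) (f : Fin l → A → ℚ) →
  ∑ (allVec xs l) (λ b → prodℚ (tabulate (λ e → f e (V.lookup b e))))
    ≡ prodℚ (tabulate (λ e → ∑ xs (f e)))
∑-allVec-product xs N.zero    f = QP.+-identityʳ 1ℚ
∑-allVec-product xs (N.suc l) f = begin
  ∑ (allVec xs (N.suc l)) (λ b → prodℚ (tabulate (λ e → f e (V.lookup b e))))
    ≡⟨ ∑-allVec-suc xs l _ ⟩
  ∑ xs (λ c → ∑ (allVec xs l) (λ w → f zero c * rest w))
    ≡⟨ ∑-cong xs (λ c → ∑-*ˡ (f zero c) rest (allVec xs l)) ⟩
  ∑ xs (λ c → f zero c * ∑ (allVec xs l) rest)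
    ≡⟨ ∑-cong xs (λ c → cong (f zero c *_) (∑-allVec-product xs l (λ e → f (suc e)))) ⟩
  ∑ xs (λ c → f zero c * prodℚ (tabulate (λ e → ∑ xs (f (suc e)))))
    ≡⟨ ∑-*ʳ _ (f zero) xs ⟩
  prodℚ (tabulate (λ e → ∑ xs (f e))) ∎
  where
  open ≡-Reasoning
  rest : Vec _ l → ℚ
  rest w = prodℚ (tabulate (λ e → f (suc e) (V.lookup w e)))

ι : ℕ → ℚ
ι c = Z.+ c / 1

toℚᵘ-ι : ∀ c → toℚᵘ (ι c) U.≃ U.mkℚᵘ (Z.+ c) 0
toℚᵘ-ι c = QP.toℚᵘ-fromℚᵘ (U.mkℚᵘ (Z.+ c) 0)

+-mkℚᵘ : ∀ a b → U.mkℚᵘ (Z.+ (a N.+ b)) 0 U.≃ U.mkℚᵘ (Z.+ a) 0 U.+ U.mkℚᵘ (Z.+ b) 0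
+-mkℚᵘ a b = U.*≡* (begin
  Z.+ (a N.+ b) Z.* Z.+ 1                         ≡⟨ ZP.*-identityʳ _ ⟩
  Z.+ a Z.+ Z.+ b                                 ≡⟨ cong₂ Z._+_ (ZP.*-identityʳ (Z.+ a)) (ZP.*-identityʳ (Z.+ b)) ⟨
  Z.+ a Z.* Z.+ 1 Z.+ Z.+ b Z.* Z.+ 1             ≡⟨ ZP.*-identityʳ _ ⟨
  (Z.+ a Z.* Z.+ 1 Z.+ Z.+ b Z.* Z.+ 1) Z.* Z.+ 1 ∎)
  where open ≡-Reasoning

ι-+ : ∀ a b → ι (a N.+ b) ≡ ι a + ι b
ι-+ a b = QP.toℚᵘ-injective (begin
  toℚᵘ (ι (a N.+ b))                          ≈⟨ toℚᵘ-ι (a N.+ b) ⟩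
  U.mkℚᵘ (Z.+ (a N.+ b)) 0                    ≈⟨ +-mkℚᵘ a b ⟩
  U.mkℚᵘ (Z.+ a) 0 U.+ U.mkℚᵘ (Z.+ b) 0       ≈⟨ UP.+-cong (toℚᵘ-ι a) (toℚᵘ-ι b) ⟨
  toℚᵘ (ι a) U.+ toℚᵘ (ι b)                   ≈⟨ QP.toℚᵘ-homo-+ (ι a) (ι b) ⟨
  toℚᵘ (ι a + ι b)                            ∎)
  where open UP.≃-Reasoning

ι-inv : ∀ c → ι (N.suc c) * inv (N.suc c) ≡ 1ℚ
ι-inv c = QP.toℚᵘ-injective (begin
  toℚᵘ (ι (N.suc c) * inv (N.suc c))                  ≈⟨ QP.toℚᵘ-homo-* (ι (N.suc c)) (inv (N.suc c)) ⟩
  toℚᵘ (ι (N.suc c)) U.* toℚᵘ (inv (N.suc c))         ≈⟨ UP.*-cong (toℚᵘ-ι (N.suc c)) (QP.toℚᵘ-fromℚᵘ (U.mkℚᵘ (Z.+ 1) c)) ⟩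
  U.mkℚᵘ (Z.+ N.suc c) 0 U.* U.mkℚᵘ (Z.+ 1) c          ≈⟨ U.*≡* integers ⟩
  toℚᵘ 1ℚ                                             ∎)
  where
  open UP.≃-Reasoning
  integers : (Z.+ N.suc c Z.* Z.+ 1) Z.* Z.+ 1 ≡ Z.+ 1 Z.* Z.+ (N.suc (c N.+ 0))
  integers = trans (ZP.*-identityʳ _) (trans (ZP.*-identityʳ _)
               (sym (trans (ZP.*-identityˡ _) (cong (λ t → Z.+ N.suc t) (NP.+-identityʳ c)))))

ι-inv-pos : ∀ c → (∃ λ c′ → c ≡ N.suc c′) → ι c * inv c ≡ 1ℚ
ι-inv-pos .(N.suc c′) (c′ , refl) = ι-inv c′

count : {A : Set} → (A → Bool) → List A → ℕ
count f xs = NLA.sum (L.map (λ a → if f a then 1 else 0) xs)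

∑-indicator : {A : Set} (f : A → Bool) (r : ℚ) (xs : List A) →
  ∑ xs (λ c → if f c then r else 0ℚ) ≡ ι (count f xs) * r
∑-indicator f r []       = sym (QP.*-zeroˡ r)
∑-indicator f r (x ∷ xs) with f x
... | true  = begin
  r + ∑ xs (λ c → if f c then r else 0ℚ)  ≡⟨ cong₂ _+_ (sym (QP.*-identityˡ r)) (∑-indicator f r xs) ⟩
  1ℚ * r + ι (count f xs) * r             ≡⟨ QP.*-distribʳ-+ r 1ℚ (ι (count f xs)) ⟨
  (1ℚ + ι (count f xs)) * r               ≡⟨ cong (_* r) (ι-+ 1 (count f xs)) ⟨
  ι (N.suc (count f xs)) * r              ∎
  where open ≡-Reasoning
... | false = trans (QP.+-identityˡ _) (∑-indicator f r xs)

count-pos : {A : Set} (f : A → Bool) (xs : List A) (a : A) → a ∈L xs → f a ≡ true →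
  ∃ λ c → count f xs ≡ N.suc c
count-pos f (x ∷ xs) .x (here refl) fx rewrite fx = count f xs , refl
count-pos f (x ∷ xs) a  (there a∈xs) fa with count-pos f xs a a∈xs fa
... | c , eq = _ , trans (cong (_ N.+_) eq) (NP.+-suc _ c)

∑-uniform : {A : Set} (f : A → Bool) (xs : List A) (a : A) → a ∈L xs → f a ≡ true →
  ∑ xs (λ c → if f c then inv (count f xs) else 0ℚ) ≡ 1ℚ
∑-uniform f xs a a∈xs fa =
  trans (∑-indicator f _ xs) (ι-inv-pos (count f xs) (count-pos f xs a a∈xs fa))

allVec-complete : ∀ l (w : Vec Bool l) → w ∈L allVec bools l
allVec-complete N.zero    V.[]            = here refl
allVec-complete (N.suc l) (false V.∷ w) =
  LMP.∈-++⁺ˡ (LMP.∈-map⁺ (false V.∷_) (allVec-complete l w))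
allVec-complete (N.suc l) (true V.∷ w)  =
  LMP.∈-++⁺ʳ (L.map (false V.∷_) (allVec bools l)) (LMP.∈-++⁺ˡ (LMP.∈-map⁺ (true V.∷_) (allVec-complete l w)))

length-cube : ∀ l → L.length (allVec bools l) ≡ 2 N.^ l
length-cube N.zero    = refl
length-cube (N.suc l) = begin
  L.length (L.map (false V.∷_) A ++ (L.map (true V.∷_) A ++ []))
    ≡⟨ LP.length-++ (L.map (false V.∷_) A) ⟩
  L.length (L.map (false V.∷_) A) N.+ L.length (L.map (true V.∷_) A ++ [])
    ≡⟨ cong₂ (λ s t → s N.+ t) (LP.length-map (false V.∷_) A) (LP.length-++ (L.map (true V.∷_) A)) ⟩
  L.length A N.+ (L.length (L.map (true V.∷_) A) N.+ 0)
    ≡⟨ cong (λ t → L.length A N.+ (t N.+ 0)) (LP.length-map (true V.∷_) A) ⟩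
  L.length A N.+ (L.length A N.+ 0)
    ≡⟨ cong (λ t → t N.+ (t N.+ 0)) (length-cube l) ⟩
  2 N.^ N.suc l ∎
  where
  open ≡-Reasoning
  A = allVec bools l

count-true : {A : Set} (xs : List A) → count (λ _ → true) xs ≡ L.length xs
count-true []       = refl
count-true (x ∷ xs) = cong N.suc (count-true xs)

∑-cube-uniform : ∀ l → ∑ (allVec bools l) (λ _ → inv (2 N.^ l)) ≡ 1ℚ
∑-cube-uniform l =
  subst (λ c → ∑ (allVec bools l) (λ _ → inv c) ≡ 1ℚ)
        (trans (count-true (allVec bools l)) (length-cube l))
        (∑-uniform (λ _ → true) (allVec bools l) (V.replicate l false) (allVec-complete l _) refl)

⊕-cancel : ∀ {l} (y c : Vec Bool l) → y ⊕ (y ⊕ c) ≡ c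
⊕-cancel V.[]      V.[]      = refl
⊕-cancel (a V.∷ y) (b V.∷ c) = cong₂ V._∷_ xor-cancel (⊕-cancel y c)
  where
  xor-cancel : a xor (a xor b) ≡ b
  xor-cancel = trans (sym (BP.xor-assoc a a b)) (cong (_xor b) (BP.xor-same a))

complement-⊕ : ∀ {l} (y c : Vec Bool l) → complement y ⊕ c ≡ complement (y ⊕ c)
complement-⊕ V.[]      V.[]      = refl
complement-⊕ (a V.∷ y) (b V.∷ c) = cong₂ V._∷_ (sym (BP.not-distribˡ-xor a b)) (complement-⊕ y c)

complement-restrict : ∀ {l r} (x : Vec Bool l) (vs : Vec (Fin l) r) →
  V.map (V.lookup (complement x)) vs ≡ complement (V.map (V.lookup x) vs)
complement-restrict x vs =
  trans (VP.map-cong (λ i → VP.lookup-map i not x) vs) (VP.map-∘ not (V.lookup x) vs)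

module Distribution {k : ℕ} (P : Vec Bool k → Bool) (symmetric : Symmetric P) (H : Hypergraph k) where
  open Dist P H
  open Symmetric symmetric using (nonempty; complInv)

  Event : Set
  Event = Assignment → Labels → Bool

  assignments : List Assignment
  assignments = allVec bools (n H)

  labelings : List Labels
  labelings = allVec (allVec bools k) (m H)

  Pr-expand : ∀ A → Pr A ≡ ∑ assignments (λ x → ∑ labelings (λ b → if A x b then prob x b else 0ℚ))
  Pr-expand A = sumℚ-concatMap _ assignments

  Pr-cong : ∀ A A′ → (∀ x b → A x b ≡ A′ x b) → Pr A ≡ Pr A′
  Pr-cong A A′ A≗A′ = begin
    Pr A
      ≡⟨ Pr-expand A ⟩
    ∑ assignments (λ x → ∑ labelings (λ b → if A x b then prob x b else 0ℚ))
      ≡⟨ ∑-cong assignments (λ x → ∑-cong labelings (λ b →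
           cong (λ t → if t then prob x b else 0ℚ) (A≗A′ x b))) ⟩
    ∑ assignments (λ x → ∑ labelings (λ b → if A′ x b then prob x b else 0ℚ))
      ≡⟨ Pr-expand A′ ⟨
    Pr A′ ∎
    where open ≡-Reasoning

  -- An edge admits the same labels under x and under its complement (P(y) = P(1-y)).
  admissible-complement : ∀ x e c → P (xOn (complement x) e ⊕ c) ≡ P (xOn x e ⊕ c)
  admissible-complement x e c = begin
    P (xOn (complement x) e ⊕ c)     ≡⟨ cong (λ y → P (y ⊕ c)) (complement-restrict x (edge H e)) ⟩
    P (complement (xOn x e) ⊕ c)     ≡⟨ cong P (complement-⊕ (xOn x e) c) ⟩
    P (complement (xOn x e ⊕ c))     ≡⟨ complInv (xOn x e ⊕ c) ⟨
    P (xOn x e ⊕ c)                  ∎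
    where open ≡-Reasoning

  edgeProb-complement : ∀ x e c → edgeProb (complement x) e c ≡ edgeProb x e c
  edgeProb-complement x e c =
    cong₂ (λ t N → if t then inv N else 0ℚ) (admissible-complement x e c)
      (cong NLA.sum (LP.map-cong (λ c′ → cong (λ t → if t then 1 else 0) (admissible-complement x e c′))
                                 (allVec bools k)))

  prob-complement : ∀ x b → prob (complement x) b ≡ prob x b
  prob-complement x b = cong (λ ps → inv (2 N.^ n H) * prodℚ ps)
    (LP.map-cong (λ e → edgeProb-complement x e (V.lookup b e)) (allFin (m H)))

  Pr-complement : ∀ A → Pr A ≡ Pr (λ x b → A (complement x) b)
  Pr-complement A = begin
    Pr A
      ≡⟨ Pr-expand A ⟩
    ∑ assignments (λ x → ∑ labelings (λ b → if A x b then prob x b else 0ℚ))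
      ≡⟨ ∑-cube-complement (n H) _ ⟩
    ∑ assignments (λ x → ∑ labelings (λ b → if A (complement x) b then prob (complement x) b else 0ℚ))
      ≡⟨ ∑-cong assignments (λ x → ∑-cong labelings (λ b →
           cong (λ p → if A (complement x) b then p else 0ℚ) (prob-complement x b))) ⟩
    ∑ assignments (λ x → ∑ labelings (λ b → if A (complement x) b then prob x b else 0ℚ))
      ≡⟨ Pr-expand _ ⟨
    Pr (λ x b → A (complement x) b) ∎
    where open ≡-Reasoning

  Pr-split : ∀ v a A → Pr A ≡ Pr (λ x b → xIs v a x b ∧ A x b) + Pr (λ x b → xIs v (not a) x b ∧ A x b)
  Pr-split v a A = begin
    Pr A
      ≡⟨ Pr-expand A ⟩
    ∑ assignments (λ x → ∑ labelings (λ b → if A x b then prob x b else 0ℚ))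
      ≡⟨ ∑-cong assignments (λ x → trans
           (∑-cong labelings (λ b → split (V.lookup x v) a (A x b) (prob x b))) (∑-+ _ _ labelings)) ⟩
    ∑ assignments (λ x → ∑ labelings (mass a x) + ∑ labelings (mass (not a) x))
      ≡⟨ ∑-+ _ _ assignments ⟩
    ∑ assignments (λ x → ∑ labelings (mass a x)) + ∑ assignments (λ x → ∑ labelings (mass (not a) x))
      ≡⟨ cong₂ _+_ (Pr-expand _) (Pr-expand _) ⟨
    Pr (λ x b → xIs v a x b ∧ A x b) + Pr (λ x b → xIs v (not a) x b ∧ A x b) ∎
    where
    open ≡-Reasoning
    mass : Bool → Assignment → Labels → ℚ
    mass a′ x b = if xIs v a′ x b ∧ A x b then prob x b else 0ℚ
    split : ∀ s a t p → (if t then p else 0ℚ) ≡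
      (if ⌊ s ≟B a ⌋ ∧ t then p else 0ℚ) + (if ⌊ s ≟B not a ⌋ ∧ t then p else 0ℚ)
    split true  true  true  p = sym (QP.+-identityʳ p)
    split true  false true  p = sym (QP.+-identityˡ p)
    split false true  true  p = sym (QP.+-identityˡ p)
    split false false true  p = sym (QP.+-identityʳ p)
    split true  true  false p = refl
    split true  false false p = refl
    split false true  false p = refl
    split false false false p = refl

  -- The label distribution of each edge sums to 1 (P has a satisfying input).
  edgeProb-total : ∀ x e → ∑ (allVec bools k) (edgeProb x e) ≡ 1ℚ
  edgeProb-total x e with nonempty
  ... | y , Py = ∑-uniform admissible (allVec bools k) (xOn x e ⊕ y) (allVec-complete k _)
                   (trans (cong P (⊕-cancel (xOn x e) y)) Py)
    where
    admissible : Vec Bool k → Bool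
    admissible c = P (xOn x e ⊕ c)

  Pr-certain : Pr (λ _ _ → true) ≡ 1ℚ
  Pr-certain = begin
    Pr (λ _ _ → true)                         ≡⟨ Pr-expand _ ⟩
    ∑ assignments (λ x → ∑ labelings (prob x)) ≡⟨ ∑-cong assignments labels-total ⟩
    ∑ assignments (λ _ → inv (2 N.^ n H))     ≡⟨ ∑-cube-uniform (n H) ⟩
    1ℚ                                        ∎
    where
    open ≡-Reasoning
    c = inv (2 N.^ n H)
    edgeTerms : Assignment → Labels → ℚ
    edgeTerms x b = prodℚ (tabulate (λ e → edgeProb x e (V.lookup b e)))
    labels-total : ∀ x → ∑ labelings (prob x) ≡ c
    labels-total x = begin
      ∑ labelings (prob x)
        ≡⟨ ∑-cong labelings (λ b → cong (λ ps → c * prodℚ ps) (LP.map-tabulate (λ e → e) (λ e → edgeProb x e (V.lookup b e)))) ⟩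
      ∑ labelings (λ b → c * edgeTerms x b)
        ≡⟨ ∑-*ˡ c (edgeTerms x) labelings ⟩
      c * ∑ labelings (edgeTerms x)
        ≡⟨ cong (c *_) (∑-allVec-product (allVec bools k) (m H) (edgeProb x)) ⟩
      c * prodℚ (tabulate (λ e → ∑ (allVec bools k) (edgeProb x e)))
        ≡⟨ cong (c *_) (prodℚ-ones (edgeProb-total x)) ⟩
      c * 1ℚ
        ≡⟨ QP.*-identityʳ c ⟩
      c ∎

  xIs-complement : ∀ v a x b → xIs v a (complement x) b ≡ xIs v (not a) x b
  xIs-complement v a x b rewrite VP.lookup-map v not x = flip-test (V.lookup x v) a
    where
    flip-test : ∀ s a → ⌊ not s ≟B a ⌋ ≡ ⌊ s ≟B not a ⌋
    flip-test true  true  = refl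
    flip-test true  false = refl
    flip-test false true  = refl
    flip-test false false = refl

  Pr-flip : ∀ v a (A : Event) → (∀ x b → A (complement x) b ≡ A x b) →
    Pr (λ x b → xIs v a x b ∧ A x b) ≡ Pr (λ x b → xIs v (not a) x b ∧ A x b)
  Pr-flip v a A invariant =
    trans (Pr-complement _) (Pr-cong _ _ (λ x b → cong₂ _∧_ (xIs-complement v a x b) (invariant x b)))

  independent : ∀ v E → Independent v E
  independent v E a β = sym (half-times-double {Pr B} {Pr (at a B)} {Pr (xIs v a)} Pr-B-halves Pr-certain-halves)
    where
    at : Bool → Event → Event
    at a′ A x b = xIs v a′ x b ∧ A x b
    B : Event
    B = bIs E β
    Pr-B-halves : Pr B ≡ Pr (at a B) + Pr (at a B)
    Pr-B-halves = trans (Pr-split v a B) (cong (Pr (at a B) +_) (sym (Pr-flip v a B (λ _ _ → refl))))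
    Pr-at-certain : ∀ a′ → Pr (at a′ (λ _ _ → true)) ≡ Pr (xIs v a′)
    Pr-at-certain a′ = Pr-cong _ _ (λ x b → BP.∧-identityʳ _)
    Pr-certain-halves : 1ℚ ≡ Pr (xIs v a) + Pr (xIs v a)
    Pr-certain-halves = begin
      1ℚ                                                        ≡⟨ Pr-certain ⟨
      Pr (λ _ _ → true)                                         ≡⟨ Pr-split v a _ ⟩
      Pr (at a (λ _ _ → true)) + Pr (at (not a) (λ _ _ → true))
        ≡⟨ cong (Pr (at a (λ _ _ → true)) +_) (Pr-flip v a (λ _ _ → true) (λ _ _ → refl)) ⟨
      Pr (at a (λ _ _ → true)) + Pr (at a (λ _ _ → true))        ≡⟨ cong₂ _+_ (Pr-at-certain a) (Pr-at-certain a) ⟩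
      Pr (xIs v a) + Pr (xIs v a)                               ∎
      where open ≡-Reasoning

lemma9 : ∀ {k : ℕ} (P : Vec Bool k → Bool) → Symmetric P →
    (H : Hypergraph k) (T : Subgraph H) → Hypertree T →
    ∀ v → v ∈ V T → Dist.Independent P H v (E T)
lemma9 P symmetric H T _ v _ = Distribution.independent P symmetric H v (E T)
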